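{- Let $L$ be a locale and let $k_1:L\to k_1L$, $k_2:L\to k_2L$ be compactifications of $L$, with associated classes $\mathcal C_{k_1},\mathcal C_{k_2}$ defined below. Then $k_1\le k_2$ if and only if $\mathcal C_{k_1}\subseteq\mathcal C_{k_2}$.
   Context: Framework: constructive set theory CZF + RRS-$\bigcup$REA (intuitionistic logic, no Powerset, Restricted Separation only). A locale $(L,B)$ is a class-frame with a set basis $B$ such that every $x$ is the join of the set $\{b\in B:b\le x\}$. $y^*=\bigvee\{c\in B:c\wedge y=0\}$; $y\prec x$ iff $1=x\vee y^*$. Regular: $a=\bigvee\{b\in B:b\prec a\}$ for $a\in B$; compact: every subset of $B$ with join $1$ has a finite subset with join $1$. A continuous map $f:L\to M$ is a function $f^-:B_M\to L$ preserving the top, binary meets in the form $f^-(a)\wedge f^-(b)=\bigvee\{f^-(c):c\in B_M,c\le a,c\le b\}$, and covers; $f^-[a]=\bigvee\{f^-(b):b\in B_M,b\le a\}$; $(f\circ g)^-(a)=g^-[f^-(a)]$. Dense: $f^-[a]=0\Rightarrow a=0$; embedding: $f^-[\cdot]$ onto; a compactification is a dense embedding into a compact regular locale. For compactifications $k,k'$ of $L$: $k\le k'$ iff $k=h\circ k'$ for some continuous $h:k'L\to kL$. For a subset $S$ of a locale, $S^*$ is the least subset containing $S$ closed under $^*$ and finite meets and joins; a sub-pcd-lattice is a set closed under these operations. For a compactification $k:L\to kL$, fix a basis $B_{kL}$ of $kL$ that is a sub-pcd-lattice, put $P_k=\{k^-(b):b\in B_{kL}\}^*$, and let $\lhd_k$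 be the least relation on $P_k$ containing $\{(k^-(b),k^-(a)):a,b\in B_{kL},b\prec a\}$ and closed under: (1) $0\lhd0$, $1\lhd1$; (2) $x\le a\lhd b\le y\Rightarrow x\lhd y$; (3) $x\lhd a,x\lhd b\Rightarrow x\lhd a\wedge b$; (4) $x\lhd a,y\lhd a\Rightarrow x\vee y\lhd a$; (5) $a\lhd b\Rightarrow b^*\lhd a^*$. $\mathcal C_k$ is the class of continuous maps $f:L\to L'$, $L'$ compact and regular, such that $y\prec x$ in $L'$ implies $f^-[y]\le p\lhd_k p'\le f^-[x]$ for some $p,p'\in P_k$ (this class does not depend on the choice of $B_{kL}$). -}

module Defs where

open import Data.Bool using (Bool; true; false; if_then_else_)
open import Data.Empty using (⊥; ⊥-elim)
open import Data.Nat using (ℕ)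
open import Data.Fin using (Fin)
open import Data.Product using (Σ; _×_; _,_; proj₁; proj₂)
open import Function using (_∘_)

-- Predicative modelling of CZF: sets = Set, classes = Set₁.
-- A locale: a class-frame (carrier a class, joins of all SET-indexed
-- families) together with a set basis B.  Equality of elements of the
-- class-frame is ≈ (mutual ≤).

record Locale : Set₂ where
  infixr 7 _∧_
  infix 4 _≤_
  field
    Carrier  : Set₁
    _≤_      : Carrier → Carrier → Set
    ≤-refl   : ∀ {x} → x ≤ x
    ≤-trans  : ∀ {x y z} → x ≤ y → y ≤ z → x ≤ z
    ⊤        : Carrier
    ⊤-max    : ∀ x → x ≤ ⊤
    _∧_      : Carrier → Carrier → Carrier
    ∧-lb₁    : ∀ x y → x ∧ y ≤ x
    ∧-lb₂    : ∀ x y → x ∧ y ≤ y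
    ∧-glb    : ∀ {x y z} → z ≤ x → z ≤ y → z ≤ x ∧ y
    ⋁        : {I : Set} → (I → Carrier) → Carrier
    ⋁-ub     : ∀ {I} (f : I → Carrier) (i : I) → f i ≤ ⋁ f
    ⋁-least  : ∀ {I} (f : I → Carrier) x → (∀ i → f i ≤ x) → ⋁ f ≤ x
    distrib  : ∀ {I} x (f : I → Carrier) → x ∧ ⋁ f ≤ ⋁ (λ i → x ∧ f i)
    B        : Set
    ι        : B → Carrier
    basis    : ∀ x → x ≤ ⋁ {Σ B (λ b → ι b ≤ x)} (ι ∘ proj₁)

  infix 4 _≈_ _≺_
  _≈_ : Carrier → Carrier → Set
  x ≈ y = (x ≤ y) × (y ≤ x)

  𝟘 : Carrier
  𝟘 = ⋁ {⊥} ⊥-elim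

  infixr 6 _∨_
  _∨_ : Carrier → Carrier → Carrier
  x ∨ y = ⋁ {Bool} (λ b → if b then x else y)

  _* : Carrier → Carrier
  y * = ⋁ {Σ B (λ c → ι c ∧ y ≈ 𝟘)} (ι ∘ proj₁)

  _≺_ : Carrier → Carrier → Set
  y ≺ x = ⊤ ≈ x ∨ (y *)

open Locale public using (Carrier)

Regular : Locale → Set
Regular L = ∀ (a : B) → ι a ≈ ⋁ {Σ B (λ b → ι b ≺ ι a)} (ι ∘ proj₁)
  where open Locale L

-- compact: every subset S of B with join 1 has a finite subset with join 1
-- (finite subset = finitely enumerated by some Fin n → B)
Compact : Locale → Set₁
Compact L =
  (S : B → Set) → ⊤ ≈ ⋁ {Σ B S} (ι ∘ proj₁) →
  Σ ℕ λ n → Σ (Fin n → B) λ e → ((i : Fin n) → S (e i)) × (⊤ ≈ ⋁ {Fin n} (ι ∘ e))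
  where open Locale L

-- Continuous maps f : L → M, given by f⁻ : B_M → L.

pre : (L M : Locale) → (Locale.B M → Carrier L) → Carrier M → Carrier L
pre L M g a = Locale.⋁ L {Σ (Locale.B M) (λ b → Locale._≤_ M (Locale.ι M b) a)} (g ∘ proj₁)

record Cont (L M : Locale) : Set₁ where
  private
    module L = Locale L
    module M = Locale M
  field
    f⁻    : Locale.B M → Carrier L
    top   : pre L M f⁻ M.⊤ L.≈ L.⊤
    meet  : ∀ a b → f⁻ a L.∧ f⁻ b L.≈
              L.⋁ {Σ (Locale.B M) (λ c → (M.ι c M.≤ M.ι a) × (M.ι c M.≤ M.ι b))} (f⁻ ∘ proj₁)
    cover : ∀ (a : Locale.B M) {I : Set} (U : I → Locale.B M) →
              M.ι a M.≤ M.⋁ (M.ι ∘ U) → f⁻ a L.≤ L.⋁ (f⁻ ∘ U)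

open Cont public using (f⁻)

infix 9 _⁻[_]
_⁻[_] : {L M : Locale} → Cont L M → Carrier M → Carrier L
_⁻[_] {L} {M} f a = pre L M (f⁻ f) a

comp⁻ : {L M N : Locale} → Cont M N → Cont L M → Locale.B N → Carrier L
comp⁻ f g a = g ⁻[ f⁻ f a ]

Dense : {L M : Locale} → Cont L M → Set₁
Dense {L} {M} f = ∀ (a : Carrier M) → f ⁻[ a ] L.≈ L.𝟘 → a M.≈ M.𝟘
  where module L = Locale L
        module M = Locale M

Embedding : {L M : Locale} → Cont L M → Set₁
Embedding {L} {M} f = ∀ (x : Carrier L) → Σ (Carrier M) λ a → f ⁻[ a ] L.≈ x
  where module L = Locale L

record Compactification (L : Locale) : Set₂ where
  field
    K       : Locale
    compact : Compact K
    regular : Regular K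
    k       : Cont L K
    dense   : Dense k
    embed   : Embedding k

_≤c_ : {L : Locale} → Compactification L → Compactification L → Set₁
_≤c_ {L} c c' =
  Σ (Cont (Compactification.K c') (Compactification.K c)) λ h →
    ∀ (a : Locale.B (Compactification.K c)) →
      f⁻ (Compactification.k c) a L.≈ comp⁻ h (Compactification.k c') a
  where module L = Locale L

-- Closure of a set under *, finite meets and finite joins (as terms).

data PCD (A : Set) : Set where
  gen       : A → PCD A
  𝟎 𝟏       : PCD A
  _∧ᵗ_ _∨ᵗ_ : PCD A → PCD A → PCD A
  _*ᵗ       : PCD A → PCD A

evalPCD : (M : Locale) {A : Set} → (A → Carrier M) → PCD A → Carrier M
evalPCD M g (gen a)  = g a
evalPCD M g 𝟎        = Locale.𝟘 M
evalPCD M g 𝟏        = Locale.⊤ M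
evalPCD M g (s ∧ᵗ t) = Locale._∧_ M (evalPCD M g s) (evalPCD M g t)
evalPCD M g (s ∨ᵗ t) = Locale._∨_ M (evalPCD M g s) (evalPCD M g t)
evalPCD M g (s *ᵗ)   = Locale._* M (evalPCD M g s)

module _ {L : Locale} (c : Compactification L) where
  private
    module L = Locale L
    K = Compactification.K c
    module K = Locale K
    k = Compactification.k c

  BK : Set
  BK = PCD (Locale.B K)

  ⟦_⟧K : BK → Carrier K
  ⟦ t ⟧K = evalPCD K K.ι t

  -- P_k = {k⁻(b) : b ∈ B_kL}^*   (k⁻ on B_kL is k⁻[·])
  Pk : Set
  Pk = PCD BK

  ⟦_⟧P : Pk → Carrier L
  ⟦ p ⟧P = evalPCD L (λ t → k ⁻[ ⟦ t ⟧K ]) p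

  data _◁_ : Pk → Pk → Set where
    base  : ∀ (b a : BK) → ⟦ b ⟧K K.≺ ⟦ a ⟧K → gen b ◁ gen a
    r0    : 𝟎 ◁ 𝟎
    r1    : 𝟏 ◁ 𝟏
    mono  : ∀ {x a b y} → ⟦ x ⟧P L.≤ ⟦ a ⟧P → a ◁ b → ⟦ b ⟧P L.≤ ⟦ y ⟧P → x ◁ y
    meet  : ∀ {x a b} → x ◁ a → x ◁ b → x ◁ (a ∧ᵗ b)
    join  : ∀ {x y a} → x ◁ a → y ◁ a → (x ∨ᵗ y) ◁ a
    star  : ∀ {a b} → a ◁ b → (b *ᵗ) ◁ (a *ᵗ)

  InC : (L' : Locale) → Compact L' → Regular L' → Cont L L' → Set₁
  InC L' _ _ f = ∀ (x y : Carrier L') → Locale._≺_ L' y x →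
    Σ Pk λ p → Σ Pk λ p' →
      (f ⁻[ y ] L.≤ ⟦ p ⟧P) × (p ◁ p') × (⟦ p' ⟧P L.≤ f ⁻[ x ])

_⊆C_ : {L : Locale} → Compactification L → Compactification L → Set₂
c ⊆C c' = ∀ (L' : Locale) (cp : Compact L') (rg : Regular L') (f : Cont _ L') →
  InC c L' cp rg f → InC c' L' cp rg f

module Submission where

open import Defs
open import Data.Bool using (true; false; if_then_else_)
open import Data.Empty using (⊥-elim)
open import Data.Fin using (Fin; zero; suc)
open import Data.Nat using (ℕ; zero; suc)
open import Data.Product using (Σ; _×_; _,_; proj₁; proj₂)
open import Data.Sum using (_⊎_; inj₁; inj₂)
open import Data.Unit using (tt) renaming (⊤ to Unit)
open import Function using (_∘_)
open import Relation.Binary.PropositionalEquality using (_≡_; refl; cong; sym; subst; subst₂)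

-- Both classes are governed by the relation A ≤≺≤ B, "A ≤ k⁻[u] and k⁻[v] ≤ B for some u ≺ v in kL":
-- ◁_k is sound for it (the star rule needs interpolation of ≺ in the compact regular kL) and
-- complete, since every u ≺ v factors through basis terms.  A map h with k₁ = h ∘ k₂ preserves ≺,
-- which gives 𝒞_{k₁} ⊆ 𝒞_{k₂}.  Conversely k₁ ∈ 𝒞_{k₁} ⊆ 𝒞_{k₂} separates every y ≺ x of k₁L by
-- some u ≺ v of k₂L, and h⁻(x) = ⋁ {c : k₂⁻[c] ≤ k₁⁻[b] for some b ≺ x} is then a frame map:
-- compactness of k₁L reduces covers to finite ones, and density of k₂ compares elements of k₂L
-- through their preimages.

⋁ᵗ : ∀ {A : Set} {n} → (Fin n → PCD A) → PCD A
⋁ᵗ {n = zero}  f = 𝟎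
⋁ᵗ {n = suc n} f = f zero ∨ᵗ ⋁ᵗ (f ∘ suc)

module FrameProperties (M : Locale) where
  open Locale M hiding (Carrier)

  x≤x∨y : ∀ {x y} → x ≤ x ∨ y
  x≤x∨y {x} {y} = ⋁-ub (λ b → if b then x else y) true

  y≤x∨y : ∀ {x y} → y ≤ x ∨ y
  y≤x∨y {x} {y} = ⋁-ub (λ b → if b then x else y) false

  ∨-least : ∀ {x y z} → x ≤ z → y ≤ z → x ∨ y ≤ z
  ∨-least {x} {y} {z} p q = ⋁-least (λ b → if b then x else y) z λ { true → p ; false → q }

  ∨-mono : ∀ {x y x′ y′} → x ≤ x′ → y ≤ y′ → x ∨ y ≤ x′ ∨ y′
  ∨-mono p q = ∨-least (≤-trans p x≤x∨y) (≤-trans q y≤x∨y)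

  ⋁-reindex : ∀ {I J : Set} {f : I → Carrier M} {g : J → Carrier M} (r : I → J) →
              (∀ i → f i ≤ g (r i)) → ⋁ f ≤ ⋁ g
  ⋁-reindex {g = g} r p = ⋁-least _ _ λ i → ≤-trans (p i) (⋁-ub g (r i))

  𝟘-least : ∀ x → 𝟘 ≤ x
  𝟘-least x = ⋁-least ⊥-elim x λ ()

  ∧-mono : ∀ {x y x′ y′} → x ≤ x′ → y ≤ y′ → x ∧ y ≤ x′ ∧ y′
  ∧-mono {x} {y} p q = ∧-glb (≤-trans (∧-lb₁ x y) p) (≤-trans (∧-lb₂ x y) q)

  ∧-comm : ∀ {x y} → x ∧ y ≤ y ∧ x
  ∧-comm {x} {y} = ∧-glb (∧-lb₂ x y) (∧-lb₁ x y)

  x≤x∧⊤ : ∀ {x} → x ≤ x ∧ ⊤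
  x≤x∧⊤ {x} = ∧-glb ≤-refl (⊤-max x)

  ∧-distribˡ-∨ : ∀ {x y z} → x ∧ (y ∨ z) ≤ (x ∧ y) ∨ (x ∧ z)
  ∧-distribˡ-∨ {x} {y} {z} = ≤-trans (distrib x (λ b → if b then y else z))
    (⋁-least _ _ λ { true → x≤x∨y ; false → y≤x∨y })

  ∧-distribʳ-∨ : ∀ {x y z} → (y ∨ z) ∧ x ≤ (y ∧ x) ∨ (z ∧ x)
  ∧-distribʳ-∨ = ≤-trans ∧-comm (≤-trans ∧-distribˡ-∨ (∨-mono ∧-comm ∧-comm))

  ∧-distribʳ-⋁ : ∀ {I} (f : I → Carrier M) x → ⋁ f ∧ x ≤ ⋁ (λ i → f i ∧ x)
  ∧-distribʳ-⋁ f x = ≤-trans ∧-comm (≤-trans (distrib x f) (⋁-reindex (λ i → i) λ _ → ∧-comm))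

  ⋁∧⋁ : ∀ {I J} (f : I → Carrier M) (g : J → Carrier M) →
        ⋁ f ∧ ⋁ g ≤ ⋁ {I × J} (λ p → f (proj₁ p) ∧ g (proj₂ p))
  ⋁∧⋁ f g = ≤-trans (∧-distribʳ-⋁ f (⋁ g)) (⋁-least _ _ λ i →
    ≤-trans (distrib (f i) g) (⋁-reindex (i ,_) λ _ → ≤-refl))

  ∧≤𝟘⇒≤* : ∀ {z y} → z ∧ y ≤ 𝟘 → z ≤ y *
  ∧≤𝟘⇒≤* {z} p = ≤-trans (basis z)
    (⋁-reindex (λ { (c , c≤z) → c , ≤-trans (∧-mono c≤z ≤-refl) p , 𝟘-least _ }) λ _ → ≤-refl)

  *∧≤𝟘 : ∀ y → y * ∧ y ≤ 𝟘
  *∧≤𝟘 y = ≤-trans (∧-distribʳ-⋁ _ y) (⋁-least _ _ (proj₁ ∘ proj₂))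

  ∧*≤𝟘 : ∀ y → y ∧ y * ≤ 𝟘
  ∧*≤𝟘 y = ≤-trans ∧-comm (*∧≤𝟘 y)

  *-antitone : ∀ {y y′} → y ≤ y′ → y′ * ≤ y *
  *-antitone {y′ = y′} p = ∧≤𝟘⇒≤* (≤-trans (∧-mono ≤-refl p) (*∧≤𝟘 y′))

  x≤x** : ∀ {y} → y ≤ y * *
  x≤x** {y} = ∧≤𝟘⇒≤* (∧*≤𝟘 y)

  ⊤≤∨⇒*≤ : ∀ {p q} → ⊤ ≤ p ∨ q → p * ≤ q
  ⊤≤∨⇒*≤ {p} {q} h = ≤-trans x≤x∧⊤ (≤-trans (∧-mono ≤-refl h)
    (≤-trans ∧-distribˡ-∨ (∨-least (≤-trans (*∧≤𝟘 p) (𝟘-least q)) (∧-lb₂ _ _))))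

  ≺-intro : ∀ {u v} → ⊤ ≤ v ∨ u * → u ≺ v
  ≺-intro p = p , ⊤-max _

  ∧*≤𝟘⇒≤ : ∀ {u v z} → u ≺ v → z ∧ u * ≤ 𝟘 → z ≤ v
  ∧*≤𝟘⇒≤ {v = v} u≺v p = ≤-trans x≤x∧⊤ (≤-trans (∧-mono ≤-refl (proj₁ u≺v))
    (≤-trans ∧-distribˡ-∨ (∨-least (∧-lb₂ _ _) (≤-trans p (𝟘-least v)))))

  ≺⇒≤ : ∀ {u v} → u ≺ v → u ≤ v
  ≺⇒≤ {u} u≺v = ∧*≤𝟘⇒≤ u≺v (∧*≤𝟘 u)

  ≺-resp-≤ : ∀ {u u′ v v′} → u′ ≤ u → u ≺ v → v ≤ v′ → u′ ≺ v′
  ≺-resp-≤ p u≺v q = ≺-intro (≤-trans (proj₁ u≺v) (∨-mono q (*-antitone p)))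

  𝟘≺ : ∀ x → 𝟘 ≺ x
  𝟘≺ x = ≺-intro (≤-trans (∧≤𝟘⇒≤* (∧-lb₂ ⊤ 𝟘)) y≤x∨y)

  ≺⊤ : ∀ {x} → x ≺ ⊤
  ≺⊤ = ≺-intro x≤x∨y

  ∨-≺ : ∀ {u₁ v₁ u₂ v₂} → u₁ ≺ v₁ → u₂ ≺ v₂ → u₁ ∨ u₂ ≺ v₁ ∨ v₂
  ∨-≺ {u₁} {v₁} {u₂} {v₂} p q =
    ≺-intro (≤-trans (∧-glb (proj₁ p) (proj₁ q)) (≤-trans ∧-distribˡ-∨ (∨-least left right)))
    where
    *∧*≤* : u₁ * ∧ u₂ * ≤ (u₁ ∨ u₂) *
    *∧*≤* = ∧≤𝟘⇒≤* (≤-trans ∧-distribˡ-∨ (∨-least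
      (≤-trans (∧-mono (∧-lb₁ _ _) ≤-refl) (*∧≤𝟘 u₁))
      (≤-trans (∧-mono (∧-lb₂ _ _) ≤-refl) (*∧≤𝟘 u₂))))
    left : (v₁ ∨ u₁ *) ∧ v₂ ≤ (v₁ ∨ v₂) ∨ (u₁ ∨ u₂) *
    left = ≤-trans (∧-lb₂ _ _) (≤-trans y≤x∨y x≤x∨y)
    right : (v₁ ∨ u₁ *) ∧ u₂ * ≤ (v₁ ∨ v₂) ∨ (u₁ ∨ u₂) *
    right = ≤-trans ∧-distribʳ-∨
      (∨-least (≤-trans (∧-lb₁ _ _) (≤-trans x≤x∨y x≤x∨y)) (≤-trans *∧*≤* y≤x∨y))

  ∧-≺ : ∀ {u₁ v₁ u₂ v₂} → u₁ ≺ v₁ → u₂ ≺ v₂ → u₁ ∧ u₂ ≺ v₁ ∧ v₂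
  ∧-≺ {u₁} {v₁} {u₂} {v₂} p q =
    ≺-intro (≤-trans (∧-glb (proj₁ p) (proj₁ q)) (≤-trans ∧-distribˡ-∨ (∨-least left right)))
    where
    left : (v₁ ∨ u₁ *) ∧ v₂ ≤ (v₁ ∧ v₂) ∨ (u₁ ∧ u₂) *
    left = ≤-trans ∧-distribʳ-∨ (∨-least x≤x∨y
      (≤-trans (∧-lb₁ _ _) (≤-trans (*-antitone (∧-lb₁ u₁ u₂)) y≤x∨y)))
    right : (v₁ ∨ u₁ *) ∧ u₂ * ≤ (v₁ ∧ v₂) ∨ (u₁ ∧ u₂) *
    right = ≤-trans (∧-lb₂ _ _) (≤-trans (*-antitone (∧-lb₂ u₁ u₂)) y≤x∨y)

  *-≺ : ∀ {u v} → u ≺ v → v * ≺ u *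
  *-≺ u≺v = ≺-intro (≤-trans (proj₁ u≺v) (∨-least (≤-trans x≤x** y≤x∨y) x≤x∨y))

  ⋁ᶠ : ∀ {n} → (Fin n → Carrier M) → Carrier M
  ⋁ᶠ {zero}  f = 𝟘
  ⋁ᶠ {suc n} f = f zero ∨ ⋁ᶠ (f ∘ suc)

  ⋁ᶠ-ub : ∀ {n} (f : Fin n → Carrier M) i → f i ≤ ⋁ᶠ f
  ⋁ᶠ-ub f zero    = x≤x∨y
  ⋁ᶠ-ub f (suc i) = ≤-trans (⋁ᶠ-ub (f ∘ suc) i) y≤x∨y

  ⋁ᶠ-least : ∀ {n} {f : Fin n → Carrier M} {x} → (∀ i → f i ≤ x) → ⋁ᶠ f ≤ x
  ⋁ᶠ-least {zero}  p = 𝟘-least _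
  ⋁ᶠ-least {suc n} p = ∨-least (p zero) (⋁ᶠ-least (p ∘ suc))

  ⋁ᶠ-≺ : ∀ {n} {f g : Fin n → Carrier M} → (∀ i → f i ≺ g i) → ⋁ᶠ f ≺ ⋁ᶠ g
  ⋁ᶠ-≺ {zero}  p = 𝟘≺ 𝟘
  ⋁ᶠ-≺ {suc n} p = ∨-≺ (p zero) (⋁ᶠ-≺ (p ∘ suc))

  ⟦⋁ᵗ⟧ : ∀ {A : Set} (g : A → Carrier M) {n} (f : Fin n → PCD A) →
         evalPCD M g (⋁ᵗ f) ≡ ⋁ᶠ (evalPCD M g ∘ f)
  ⟦⋁ᵗ⟧ g {zero}  f = refl
  ⟦⋁ᵗ⟧ g {suc n} f = cong (evalPCD M g (f zero) ∨_) (⟦⋁ᵗ⟧ g (f ∘ suc))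

module PreimageProperties {L M : Locale} (f : Cont L M) where
  private
    module L = Locale L
    module M = Locale M
    module FL = FrameProperties L
    module FM = FrameProperties M

  pre-mono : ∀ {x y} → x M.≤ y → f ⁻[ x ] L.≤ f ⁻[ y ]
  pre-mono p = FL.⋁-reindex (λ { (b , b≤x) → b , M.≤-trans b≤x p }) λ _ → L.≤-refl

  pre-ι-≥ : ∀ b → f⁻ f b L.≤ f ⁻[ M.ι b ]
  pre-ι-≥ b = L.⋁-ub (f⁻ f ∘ proj₁) (b , M.≤-refl)

  pre-ι-≤ : ∀ b → f ⁻[ M.ι b ] L.≤ f⁻ f b
  pre-ι-≤ b = L.⋁-least _ _ λ { (c , c≤b) → L.≤-trans
    (Cont.cover f c {Unit} (λ _ → b) (M.≤-trans c≤b (M.⋁-ub (λ _ → M.ι b) tt)))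
    (L.⋁-least _ _ λ _ → L.≤-refl) }

  pre-⋁-≤ : ∀ {I} (F : I → Carrier M) → f ⁻[ M.⋁ F ] L.≤ L.⋁ (λ i → f ⁻[ F i ])
  pre-⋁-≤ {I} F = L.⋁-least _ _ λ { (b , b≤⋁F) → L.≤-trans
    (Cont.cover f b (proj₁ ∘ proj₂) (M.≤-trans b≤⋁F ⋁F≤⋁basis))
    (FL.⋁-reindex proj₁ λ { (i , c , c≤Fi) → L.⋁-ub (f⁻ f ∘ proj₁) (c , c≤Fi) }) }
    where
    ⋁F≤⋁basis : M.⋁ F M.≤ M.⋁ {Σ I λ i → Σ M.B λ c → M.ι c M.≤ F i} (M.ι ∘ proj₁ ∘ proj₂)
    ⋁F≤⋁basis = M.⋁-least _ _ λ i → M.≤-trans (M.basis (F i))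
      (FM.⋁-reindex (λ { (c , c≤Fi) → i , c , c≤Fi }) λ _ → M.≤-refl)

  pre-𝟘-≤ : f ⁻[ M.𝟘 ] L.≤ L.𝟘
  pre-𝟘-≤ = L.≤-trans (pre-⋁-≤ ⊥-elim) (L.⋁-least _ _ λ ())

  pre-⊤-≥ : L.⊤ L.≤ f ⁻[ M.⊤ ]
  pre-⊤-≥ = proj₂ (Cont.top f)

  pre-∨-≤ : ∀ {x y} → f ⁻[ x M.∨ y ] L.≤ f ⁻[ x ] L.∨ f ⁻[ y ]
  pre-∨-≤ = L.≤-trans (pre-⋁-≤ _) (L.⋁-least _ _ λ { true → FL.x≤x∨y ; false → FL.y≤x∨y })

  pre-∨-≥ : ∀ {x y} → f ⁻[ x ] L.∨ f ⁻[ y ] L.≤ f ⁻[ x M.∨ y ]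
  pre-∨-≥ = FL.∨-least (pre-mono FM.x≤x∨y) (pre-mono FM.y≤x∨y)

  pre-∧-≤ : ∀ {x y} → f ⁻[ x M.∧ y ] L.≤ f ⁻[ x ] L.∧ f ⁻[ y ]
  pre-∧-≤ = L.∧-glb (pre-mono (M.∧-lb₁ _ _)) (pre-mono (M.∧-lb₂ _ _))

  pre-∧-≥ : ∀ {x y} → f ⁻[ x ] L.∧ f ⁻[ y ] L.≤ f ⁻[ x M.∧ y ]
  pre-∧-≥ = L.≤-trans (FL.⋁∧⋁ _ _) (L.⋁-least _ _ λ { ((b , b≤x) , (c , c≤y)) →
    L.≤-trans (proj₁ (Cont.meet f b c)) (FL.⋁-reindex
      (λ { (d , d≤b , d≤c) → d , M.∧-glb (M.≤-trans d≤b b≤x) (M.≤-trans d≤c c≤y) })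
      λ _ → L.≤-refl) })

  pre-⋁ᶠ-≤ : ∀ {n} (g : Fin n → Carrier M) → f ⁻[ FM.⋁ᶠ g ] L.≤ FL.⋁ᶠ (λ i → f ⁻[ g i ])
  pre-⋁ᶠ-≤ {zero}  g = pre-𝟘-≤
  pre-⋁ᶠ-≤ {suc n} g = L.≤-trans pre-∨-≤ (FL.∨-mono L.≤-refl (pre-⋁ᶠ-≤ (g ∘ suc)))

  pre-* : ∀ {x} → f ⁻[ x M.* ] L.≤ (f ⁻[ x ]) L.*
  pre-* {x} = FL.∧≤𝟘⇒≤* (L.≤-trans pre-∧-≥ (L.≤-trans (pre-mono (FM.*∧≤𝟘 x)) pre-𝟘-≤))

  pre-⊤≤∨ : ∀ {x y} → M.⊤ M.≤ x M.∨ y → L.⊤ L.≤ f ⁻[ x ] L.∨ f ⁻[ y ]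
  pre-⊤≤∨ p = L.≤-trans pre-⊤-≥ (L.≤-trans (pre-mono p) pre-∨-≤)

  pre-≺ : ∀ {u v} → u M.≺ v → f ⁻[ u ] L.≺ f ⁻[ v ]
  pre-≺ u≺v = FL.≺-intro (L.≤-trans (pre-⊤≤∨ (proj₁ u≺v)) (FL.∨-mono L.≤-refl pre-*))

module _ {L M N : Locale} (f : Cont L N) (g : Cont L M) (h : Cont M N) where
  private
    module L = Locale L
    module M = Locale M
    module FL = FrameProperties L
    module g⁻ = PreimageProperties g

  pre-∘ : (∀ a → f⁻ f a L.≈ comp⁻ h g a) → ∀ w → f ⁻[ w ] L.≈ g ⁻[ h ⁻[ w ] ]
  pre-∘ f≈h∘g w =
    L.⋁-least _ _ (λ { (a , a≤w) → L.≤-trans (proj₁ (f≈h∘g a))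
      (g⁻.pre-mono (M.⋁-ub (f⁻ h ∘ proj₁) (a , a≤w))) }) ,
    L.≤-trans (g⁻.pre-⋁-≤ _)
      (FL.⋁-reindex (λ a → a) λ { (a , a≤w) → proj₂ (f≈h∘g a) })

module Regularity (M : Locale) (rg : Regular M) where
  open Locale M hiding (Carrier)
  open FrameProperties M

  ≤⋁≺ : ∀ x → x ≤ ⋁ {Σ B λ e → ι e ≺ x} (ι ∘ proj₁)
  ≤⋁≺ x = ≤-trans (basis x) (⋁-least _ _ λ { (a , a≤x) → ≤-trans (proj₁ (rg a))
    (⋁-reindex (λ { (e , e≺a) → e , ≺-resp-≤ ≤-refl e≺a a≤x }) λ _ → ≤-refl) })

module CompactRegular (M : Locale) (cp : Compact M) (rg : Regular M) where
  open Locale M hiding (Carrier)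
  open FrameProperties M
  open Regularity M rg

  ⟦_⟧ : PCD B → Carrier M
  ⟦_⟧ = evalPCD M ι

  Links : ∀ {I} → (I → Carrier M) → B → Set
  Links {I} F c = Σ B λ e → Σ I λ i → (ι c ≺ ι e) × (ι e ≺ F i)

  ≤⋁Links : ∀ {I} (F : I → Carrier M) i → F i ≤ ⋁ {Σ B (Links F)} (ι ∘ proj₁)
  ≤⋁Links F i = ≤-trans (≤⋁≺ (F i)) (⋁-least _ _ λ { (e , e≺Fi) → ≤-trans (≤⋁≺ (ι e))
    (⋁-reindex (λ { (c , c≺e) → c , e , i , c≺e , e≺Fi }) λ _ → ≤-refl) })

  Cover : ∀ {I} → (I → Carrier M) → Carrier M → B → Set
  Cover F y c = Links F c ⊎ (ι c ∧ y ≈ 𝟘)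

  lowerᵗ upperᵗ : ∀ {I} {F : I → Carrier M} {y} → Σ B (Cover F y) → PCD B
  lowerᵗ (c , inj₁ _) = gen c
  lowerᵗ (c , inj₂ _) = 𝟎
  upperᵗ (c , inj₁ (e , _)) = gen e
  upperᵗ (c , inj₂ _) = 𝟎

  lower upper : ∀ {I} {F : I → Carrier M} {y} → Σ B (Cover F y) → Carrier M
  lower = ⟦_⟧ ∘ lowerᵗ
  upper = ⟦_⟧ ∘ upperᵗ

  lower≺upper : ∀ {I} {F : I → Carrier M} {y} (s : Σ B (Cover F y)) → lower s ≺ upper s
  lower≺upper (c , inj₁ (e , i , c≺e , e≺Fi)) = c≺e
  lower≺upper (c , inj₂ _) = 𝟘≺ 𝟘

  y∧≤lower : ∀ {I} {F : I → Carrier M} {y} (s : Σ B (Cover F y)) → y ∧ ι (proj₁ s) ≤ lower s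
  y∧≤lower (c , inj₁ _) = ∧-lb₂ _ _
  y∧≤lower (c , inj₂ c∧y≈𝟘) = ≤-trans ∧-comm (proj₁ c∧y≈𝟘)

  ⊤≤⋁Cover : ∀ {I} (F : I → Carrier M) {y} → y ≺ ⋁ F → ⊤ ≤ ⋁ {Σ B (Cover F y)} (ι ∘ proj₁)
  ⊤≤⋁Cover F y≺⋁F = ≤-trans (proj₁ y≺⋁F) (∨-least
    (⋁-least _ _ λ i → ≤-trans (≤⋁Links F i) (⋁-reindex (λ (c , l) → c , inj₁ l) λ _ → ≤-refl))
    (⋁-reindex (λ (c , c∧y≈𝟘) → c , inj₂ c∧y≈𝟘) λ _ → ≤-refl))

  ≺⋁⇒finite-cover : ∀ {I} (F : I → Carrier M) {y} → y ≺ ⋁ F →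
                    Σ ℕ λ n → Σ (Fin n → Σ B (Cover F y)) λ t → y ≤ ⋁ᶠ (lower ∘ t)
  ≺⋁⇒finite-cover F {y} y≺⋁F with cp (Cover F y) (⊤≤⋁Cover F y≺⋁F , ⊤-max _)
  ... | n , cs , covers , ⊤≈⋁cs = n , t , ≤-trans x≤x∧⊤ (≤-trans (∧-mono ≤-refl (proj₁ ⊤≈⋁cs))
      (≤-trans (distrib y _) (⋁-least _ _ λ j → ≤-trans (y∧≤lower (t j)) (⋁ᶠ-ub (lower ∘ t) j))))
    where
    t : Fin n → Σ B (Cover F y)
    t j = cs j , covers j

  ≺-basis-interpolant : ∀ {u v} → u ≺ v →
    Σ (PCD B) λ b → Σ (PCD B) λ a → (u ≤ ⟦ b ⟧) × (⟦ b ⟧ ≺ ⟦ a ⟧) × (⟦ a ⟧ ≺ v)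
  ≺-basis-interpolant {u} {v} u≺v
    with ≺⋁⇒finite-cover (λ (_ : Unit) → v) (≺-resp-≤ ≤-refl u≺v (⋁-ub _ tt))
  ... | n , t , u≤ = ⋁ᵗ (lowerᵗ ∘ t) , ⋁ᵗ (upperᵗ ∘ t) ,
    subst (u ≤_) (sym ⟦lower⟧) u≤ ,
    subst₂ _≺_ (sym ⟦lower⟧) (sym ⟦upper⟧) (⋁ᶠ-≺ (lower≺upper ∘ t)) ,
    subst (_≺ v) (sym ⟦upper⟧) (≺-resp-≤ ≤-refl (⋁ᶠ-≺ (upper≺v ∘ t)) (⋁ᶠ-least {n} λ _ → ≤-refl))
    where
    ⟦lower⟧ : ⟦ ⋁ᵗ (lowerᵗ ∘ t) ⟧ ≡ ⋁ᶠ (lower ∘ t)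
    ⟦lower⟧ = ⟦⋁ᵗ⟧ ι (lowerᵗ ∘ t)
    ⟦upper⟧ : ⟦ ⋁ᵗ (upperᵗ ∘ t) ⟧ ≡ ⋁ᶠ (upper ∘ t)
    ⟦upper⟧ = ⟦⋁ᵗ⟧ ι (upperᵗ ∘ t)
    upper≺v : (s : Σ B (Cover (λ (_ : Unit) → v) u)) → upper s ≺ v
    upper≺v (c , inj₁ (e , _ , _ , e≺v)) = e≺v
    upper≺v (c , inj₂ _) = 𝟘≺ v

  ≺-interpolate : ∀ {u v} → u ≺ v → Σ (Carrier M) λ w → (u ≺ w) × (w ≺ v)
  ≺-interpolate u≺v =
    let b , a , u≤b , b≺a , a≺v = ≺-basis-interpolant u≺v in ⟦ a ⟧ , ≺-resp-≤ u≤b b≺a ≤-refl , a≺v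

module CompactificationProperties {L : Locale} (c : Compactification L) where
  open Compactification c
  private
    module L = Locale L
    module K = Locale K
    module FL = FrameProperties L
    module FK = FrameProperties K
    module KR = CompactRegular K compact regular
    module k⁻ = PreimageProperties k

    ⟦_⟧ : Pk c → Carrier L
    ⟦_⟧ = ⟦_⟧P c

    _◁ₖ_ : Pk c → Pk c → Set
    _◁ₖ_ = _◁_ c

  dense-≺ : ∀ {z u v} → k ⁻[ z ] L.≤ k ⁻[ u ] → u K.≺ v → z K.≤ v
  dense-≺ {z} {u} p u≺v = FK.∧*≤𝟘⇒≤ u≺v (proj₁ (dense (z K.∧ u K.*) (pre≤𝟘 , FL.𝟘-least _)))
    where
    pre≤𝟘 : k ⁻[ z K.∧ u K.* ] L.≤ L.𝟘
    pre≤𝟘 = L.≤-trans k⁻.pre-∧-≤ (L.≤-trans (FL.∧-mono p k⁻.pre-*) (FL.∧*≤𝟘 _))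

  infix 4 _≤≺≤_ _≤◁≤_ _≤≺_

  _≤≺≤_ : Carrier L → Carrier L → Set₁
  A ≤≺≤ B = Σ (Carrier K) λ u → Σ (Carrier K) λ v →
    (u K.≺ v) × (A L.≤ k ⁻[ u ]) × (k ⁻[ v ] L.≤ B)

  _≤◁≤_ : Carrier L → Carrier L → Set
  A ≤◁≤ B = Σ (Pk c) λ p → Σ (Pk c) λ p′ → (A L.≤ ⟦ p ⟧) × (p ◁ₖ p′) × (⟦ p′ ⟧ L.≤ B)

  ≤≺≤-resp-≤ : ∀ {A A′ B B′} → A′ L.≤ A → A ≤≺≤ B → B L.≤ B′ → A′ ≤≺≤ B′
  ≤≺≤-resp-≤ A′≤A (u , v , u≺v , A≤u , v≤B) B≤B′ =
    u , v , u≺v , L.≤-trans A′≤A A≤u , L.≤-trans v≤B B≤B′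

  ≤≺≤-∧ : ∀ {A B B′} → A ≤≺≤ B → A ≤≺≤ B′ → A ≤≺≤ B L.∧ B′
  ≤≺≤-∧ (u , v , u≺v , A≤u , v≤B) (u′ , v′ , u′≺v′ , A≤u′ , v′≤B′) =
    u K.∧ u′ , v K.∧ v′ , FK.∧-≺ u≺v u′≺v′ ,
    L.≤-trans (L.∧-glb A≤u A≤u′) k⁻.pre-∧-≥ , L.≤-trans k⁻.pre-∧-≤ (FL.∧-mono v≤B v′≤B′)

  ≤≺≤-∨ : ∀ {A A′ B} → A ≤≺≤ B → A′ ≤≺≤ B → A L.∨ A′ ≤≺≤ B
  ≤≺≤-∨ (u , v , u≺v , A≤u , v≤B) (u′ , v′ , u′≺v′ , A′≤u′ , v′≤B) =
    u K.∨ u′ , v K.∨ v′ , FK.∨-≺ u≺v u′≺v′ ,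
    L.≤-trans (FL.∨-mono A≤u A′≤u′) k⁻.pre-∨-≥ , L.≤-trans k⁻.pre-∨-≤ (FL.∨-least v≤B v′≤B)

  ≤≺≤-* : ∀ {A B} → A ≤≺≤ B → B L.* ≤≺≤ A L.*
  ≤≺≤-* (u , v , u≺v , A≤u , v≤B) =
    let w , u≺w , w≺v = KR.≺-interpolate u≺v in
    w K.* , u K.* , FK.*-≺ u≺w ,
    L.≤-trans (FL.*-antitone v≤B) (FL.⊤≤∨⇒*≤ (k⁻.pre-⊤≤∨ (proj₁ w≺v))) ,
    L.≤-trans k⁻.pre-* (FL.*-antitone A≤u)

  ◁⇒≤≺≤ : ∀ {p p′} → p ◁ₖ p′ → ⟦ p ⟧ ≤≺≤ ⟦ p′ ⟧
  ◁⇒≤≺≤ (base b a b≺a)     = _ , _ , b≺a , L.≤-refl , L.≤-refl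
  ◁⇒≤≺≤ r0                 = K.𝟘 , K.𝟘 , FK.𝟘≺ K.𝟘 , FL.𝟘-least _ , k⁻.pre-𝟘-≤
  ◁⇒≤≺≤ r1                 = K.⊤ , K.⊤ , FK.≺⊤ , k⁻.pre-⊤-≥ , L.⊤-max _
  ◁⇒≤≺≤ (mono x≤a a◁b b≤y) = ≤≺≤-resp-≤ x≤a (◁⇒≤≺≤ a◁b) b≤y
  ◁⇒≤≺≤ (meet x◁a x◁b)     = ≤≺≤-∧ (◁⇒≤≺≤ x◁a) (◁⇒≤≺≤ x◁b)
  ◁⇒≤≺≤ (join x◁a y◁a)     = ≤≺≤-∨ (◁⇒≤≺≤ x◁a) (◁⇒≤≺≤ y◁a)
  ◁⇒≤≺≤ (star a◁b)         = ≤≺≤-* (◁⇒≤≺≤ a◁b)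

  ≤≺≤⇒≤◁≤ : ∀ {A B} → A ≤≺≤ B → A ≤◁≤ B
  ≤≺≤⇒≤◁≤ (u , v , u≺v , A≤u , v≤B) =
    let b , a , u≤b , b≺a , a≺v = KR.≺-basis-interpolant u≺v in
    gen b , gen a ,
    L.≤-trans A≤u (k⁻.pre-mono u≤b) , base b a b≺a , L.≤-trans (k⁻.pre-mono (FK.≺⇒≤ a≺v)) v≤B

  InC⇒≤≺≤ : ∀ {L′} (cp : Compact L′) (rg : Regular L′) (f : Cont L L′) → InC c L′ cp rg f →
            ∀ {x y} → Locale._≺_ L′ y x → f ⁻[ y ] ≤≺≤ f ⁻[ x ]
  InC⇒≤≺≤ cp rg f f∈C {x} {y} y≺x =
    let p , p′ , y≤p , p◁p′ , p′≤x = f∈C x y y≺x in ≤≺≤-resp-≤ y≤p (◁⇒≤≺≤ p◁p′) p′≤x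

  ≤≺≤⇒InC : ∀ {L′} (cp : Compact L′) (rg : Regular L′) (f : Cont L L′) →
            (∀ {x y} → Locale._≺_ L′ y x → f ⁻[ y ] ≤≺≤ f ⁻[ x ]) → InC c L′ cp rg f
  ≤≺≤⇒InC cp rg f sep x y y≺x = ≤≺≤⇒≤◁≤ (sep y≺x)

  k∈C : InC c K compact regular k
  k∈C = ≤≺≤⇒InC compact regular k λ {x} {y} y≺x → y , x , y≺x , L.≤-refl , L.≤-refl

  _≤≺_ : Carrier L → Carrier K → Set₁
  A ≤≺ w = Σ (Carrier K) λ u → (A L.≤ k ⁻[ u ]) × (u K.≺ w)

  ⋁ᶠ-≤≺ : ∀ {n} {A : Fin n → Carrier L} {w} → (∀ j → A j ≤≺ w) → FL.⋁ᶠ A ≤≺ w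
  ⋁ᶠ-≤≺ {zero}  _ = K.𝟘 , FL.𝟘-least _ , FK.𝟘≺ _
  ⋁ᶠ-≤≺ {suc n} A≤≺w =
    let u , A≤u , u≺w = A≤≺w zero
        u′ , A′≤u′ , u′≺w = ⋁ᶠ-≤≺ (A≤≺w ∘ suc)
    in u K.∨ u′ , L.≤-trans (FL.∨-mono A≤u A′≤u′) k⁻.pre-∨-≥ ,
    FK.≺-resp-≤ K.≤-refl (FK.∨-≺ u≺w u′≺w) (FK.∨-least K.≤-refl K.≤-refl)

  ≤≺-dense : ∀ {z A w} → k ⁻[ z ] L.≤ A → A ≤≺ w → z K.≤ w
  ≤≺-dense z≤A (u , A≤u , u≺w) = dense-≺ (L.≤-trans z≤A A≤u) u≺w

≤c⇒⊆C : {L : Locale} (c₁ c₂ : Compactification L) → c₁ ≤c c₂ → c₁ ⊆C c₂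
≤c⇒⊆C {L} c₁ c₂ (h , k₁≈h∘k₂) L′ cp rg f f∈C₁ =
  C₂.≤≺≤⇒InC cp rg f λ y≺x → transfer (C₁.InC⇒≤≺≤ cp rg f f∈C₁ y≺x)
  where
  open Compactification c₁ using () renaming (k to k₁)
  open Compactification c₂ using () renaming (k to k₂)
  module L = Locale L
  module C₁ = CompactificationProperties c₁
  module C₂ = CompactificationProperties c₂
  module h⁻ = PreimageProperties h

  transfer : ∀ {A B} → A C₁.≤≺≤ B → A C₂.≤≺≤ B
  transfer (u , v , u≺v , A≤u , v≤B) = h ⁻[ u ] , h ⁻[ v ] , h⁻.pre-≺ u≺v ,
    L.≤-trans A≤u (proj₁ (pre-∘ k₁ k₂ h k₁≈h∘k₂ u)) ,
    L.≤-trans (proj₂ (pre-∘ k₁ k₂ h k₁≈h∘k₂ v)) v≤B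

module InducedMap {L : Locale} (c₁ c₂ : Compactification L) (sub : c₁ ⊆C c₂) where
  open Compactification c₁ using ()
    renaming (K to K₁; k to k₁; compact to compact₁; regular to regular₁)
  open Compactification c₂ using () renaming (K to K₂; k to k₂; embed to embed₂)
  private
    module L = Locale L
    module K₁ = Locale K₁
    module K₂ = Locale K₂
    module FL = FrameProperties L
    module FK₁ = FrameProperties K₁
    module FK₂ = FrameProperties K₂
    module k₁⁻ = PreimageProperties k₁
    module k₂⁻ = PreimageProperties k₂
    module Reg₁ = Regularity K₁ regular₁
    module R₁ = CompactRegular K₁ compact₁ regular₁
    module C₁ = CompactificationProperties c₁
    module C₂ = CompactificationProperties c₂

  separate : ∀ {x y} → y K₁.≺ x → k₁ ⁻[ y ] C₂.≤≺≤ k₁ ⁻[ x ]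
  separate = C₂.InC⇒≤≺≤ compact₁ regular₁ k₁ (sub K₁ compact₁ regular₁ k₁ C₁.k∈C)

  Witness : Carrier K₁ → K₂.B → Set
  Witness x c = Σ K₁.B λ b → (K₁.ι b K₁.≺ x) × (k₂ ⁻[ K₂.ι c ] L.≤ k₁ ⁻[ K₁.ι b ])

  h⁻ : Carrier K₁ → Carrier K₂
  h⁻ x = K₂.⋁ {Σ K₂.B (Witness x)} (K₂.ι ∘ proj₁)

  h⁻-mono : ∀ {x x′} → x K₁.≤ x′ → h⁻ x K₂.≤ h⁻ x′
  h⁻-mono x≤x′ = FK₂.⋁-reindex
    (λ { (c , b , b≺x , c≤b) → c , b , FK₁.≺-resp-≤ K₁.≤-refl b≺x x≤x′ , c≤b }) λ _ → K₂.≤-refl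

  ≤h⁻-basis : ∀ {v e x} → K₁.ι e K₁.≺ x → k₂ ⁻[ v ] L.≤ k₁ ⁻[ K₁.ι e ] → v K₂.≤ h⁻ x
  ≤h⁻-basis {v} e≺x v≤e = K₂.≤-trans (K₂.basis v)
    (FK₂.⋁-reindex (λ { (c , c≤v) → c , _ , e≺x , L.≤-trans (k₂⁻.pre-mono c≤v) v≤e })
      λ _ → K₂.≤-refl)

  -- The one place where compactness of k₁L and density of k₂ enter.
  ≤⋁h⁻ : ∀ {I} (F : I → Carrier K₁) {y z} → y K₁.≺ K₁.⋁ F → k₂ ⁻[ z ] L.≤ k₁ ⁻[ y ] →
         z K₂.≤ K₂.⋁ (h⁻ ∘ F)
  ≤⋁h⁻ F y≺⋁F z≤y =
    let n , t , y≤⋁lower = R₁.≺⋁⇒finite-cover F y≺⋁F in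
    C₂.≤≺-dense (L.≤-trans z≤y (L.≤-trans (k₁⁻.pre-mono y≤⋁lower) (k₁⁻.pre-⋁ᶠ-≤ (R₁.lower ∘ t))))
                (C₂.⋁ᶠ-≤≺ (piece ∘ t))
    where
    piece : ∀ {y} (s : Σ K₁.B (R₁.Cover F y)) → k₁ ⁻[ R₁.lower s ] C₂.≤≺ K₂.⋁ (h⁻ ∘ F)
    piece (c , inj₁ (e , i , c≺e , e≺Fi)) =
      let u , v , u≺v , c≤u , v≤e = separate c≺e in
      u , c≤u , FK₂.≺-resp-≤ K₂.≤-refl u≺v (K₂.≤-trans (≤h⁻-basis e≺Fi v≤e) (K₂.⋁-ub (h⁻ ∘ F) i))
    piece (c , inj₂ _) = K₂.𝟘 , L.≤-trans k₁⁻.pre-𝟘-≤ (FL.𝟘-least _) , FK₂.𝟘≺ _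

  ≤h⁻ : ∀ {x y z} → y K₁.≺ x → k₂ ⁻[ z ] L.≤ k₁ ⁻[ y ] → z K₂.≤ h⁻ x
  ≤h⁻ {x} y≺x z≤y = K₂.≤-trans
    (≤⋁h⁻ (λ (_ : Unit) → x) (FK₁.≺-resp-≤ K₁.≤-refl y≺x (K₁.⋁-ub _ tt)) z≤y)
    (K₂.⋁-least _ _ λ _ → K₂.≤-refl)

  h⁻-cover : ∀ {I} {x} (F : I → Carrier K₁) → x K₁.≤ K₁.⋁ F → h⁻ x K₂.≤ K₂.⋁ (h⁻ ∘ F)
  h⁻-cover F x≤⋁F = K₂.⋁-least _ _ λ { (c , b , b≺x , c≤b) →
    ≤⋁h⁻ F (FK₁.≺-resp-≤ K₁.≤-refl b≺x x≤⋁F) c≤b }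

  h⁻-∧ : ∀ {x x′} → h⁻ x K₂.∧ h⁻ x′ K₂.≤ h⁻ (x K₁.∧ x′)
  h⁻-∧ = K₂.≤-trans (FK₂.⋁∧⋁ _ _) (K₂.⋁-least _ _
    λ { ((c , b , b≺x , c≤b) , (c′ , b′ , b′≺x′ , c′≤b′)) → ≤h⁻ (FK₁.∧-≺ b≺x b′≺x′)
          (L.≤-trans k₂⁻.pre-∧-≤ (L.≤-trans (FL.∧-mono c≤b c′≤b′) k₁⁻.pre-∧-≥)) })

  h : Cont K₂ K₁
  h = record
    { f⁻    = h⁻ ∘ K₁.ι
    ; top   = K₂.⊤-max _ , K₂.≤-trans ⊤≤h⁻⊤ (h⁻-cover _ (K₁.basis K₁.⊤))
    ; meet  = λ a b → K₂.≤-trans h⁻-∧ (h⁻-cover _ (a∧b≤⋁ a b)) ,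
                      K₂.⋁-least _ _ λ { (d , d≤a , d≤b) → K₂.∧-glb (h⁻-mono d≤a) (h⁻-mono d≤b) }
    ; cover = λ a U → h⁻-cover (K₁.ι ∘ U)
    }
    where
    ⊤≤h⁻⊤ : K₂.⊤ K₂.≤ h⁻ K₁.⊤
    ⊤≤h⁻⊤ = ≤h⁻ FK₁.≺⊤ (L.≤-trans (L.⊤-max _) k₁⁻.pre-⊤-≥)
    a∧b≤⋁ : ∀ a b → K₁.ι a K₁.∧ K₁.ι b K₁.≤
            K₁.⋁ {Σ K₁.B λ d → (K₁.ι d K₁.≤ K₁.ι a) × (K₁.ι d K₁.≤ K₁.ι b)} (K₁.ι ∘ proj₁)
    a∧b≤⋁ a b = K₁.≤-trans (K₁.basis _) (FK₁.⋁-reindex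
      (λ { (d , d≤a∧b) → d , K₁.≤-trans d≤a∧b (K₁.∧-lb₁ _ _) , K₁.≤-trans d≤a∧b (K₁.∧-lb₂ _ _) })
      λ _ → K₁.≤-refl)

  k₁⁻≤k₂⁻h⁻ : ∀ x → k₁ ⁻[ x ] L.≤ k₂ ⁻[ h⁻ x ]
  k₁⁻≤k₂⁻h⁻ x = L.≤-trans (k₁⁻.pre-mono (Reg₁.≤⋁≺ x))
    (L.≤-trans (k₁⁻.pre-⋁-≤ _) (L.⋁-least _ _ λ { (b , b≺x) →
      let w , k₂w≈k₁b = embed₂ (k₁ ⁻[ K₁.ι b ]) in
      L.≤-trans (proj₂ k₂w≈k₁b) (k₂⁻.pre-mono (≤h⁻-basis b≺x (proj₁ k₂w≈k₁b))) }))

  k₂⁻h⁻≤k₁⁻ : ∀ x → k₂ ⁻[ h⁻ x ] L.≤ k₁ ⁻[ x ]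
  k₂⁻h⁻≤k₁⁻ x = L.≤-trans (k₂⁻.pre-⋁-≤ _) (L.⋁-least _ _ λ { (c , b , b≺x , c≤b) →
    L.≤-trans c≤b (k₁⁻.pre-mono (FK₁.≺⇒≤ b≺x)) })

  k₁≈h∘k₂ : ∀ a → f⁻ k₁ a L.≈ comp⁻ h k₂ a
  k₁≈h∘k₂ a = L.≤-trans (k₁⁻.pre-ι-≥ a) (k₁⁻≤k₂⁻h⁻ _) , L.≤-trans (k₂⁻h⁻≤k₁⁻ _) (k₁⁻.pre-ι-≤ a)

⊆C⇒≤c : {L : Locale} (c₁ c₂ : Compactification L) → c₁ ⊆C c₂ → c₁ ≤c c₂
⊆C⇒≤c c₁ c₂ sub = h , k₁≈h∘k₂
  where open InducedMap c₁ c₂ sub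

mainTheorem15 : (L : Locale) (k₁ k₂ : Compactification L) →
    (k₁ ≤c k₂ → k₁ ⊆C k₂) × (k₁ ⊆C k₂ → k₁ ≤c k₂)
mainTheorem15 L k₁ k₂ = ≤c⇒⊆C k₁ k₂ , ⊆C⇒≤c k₁ k₂
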